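{- Let $n\ge 3$ be an integer. Then $\alpha_=(Q_n)\ge 2^{n-2}$.
   Context: $Q_n$ is the hypercube on $\{0,1\}^n$, vertices adjacent iff they differ in exactly one coordinate; it is bipartite with classes the vertices of even and of odd Hamming weight. For a bipartite graph $G$ with bipartition classes $V_0,V_1$, the equi-independence number $\alpha_=(G)$ is the maximum cardinality of an independent set $I$ of $G$ with $|I\cap V_0|=|I\cap V_1|$. -}

module Defs where

open import Data.Nat using (ℕ; zero; suc; _+_; _%_)
open import Data.Bool using (Bool; true; false; if_then_else_)
open import Data.Vec using (Vec; []; _∷_)
open import Data.List using (List; length; filter)
open import Data.List.Relation.Unary.Unique.Propositional using (Unique)
open import Data.List.Relation.Unary.All using (All)
open import Data.List.Membership.Propositional using (_∈_)
open import Data.Product using (_×_)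
open import Relation.Binary.PropositionalEquality using (_≡_)
open import Relation.Nullary using (¬_)
open import Data.Nat using (_≟_)
open import Relation.Nullary.Decidable using (⌊_⌋)

Vertex : ℕ → Set
Vertex n = Vec Bool n

hamming : ∀ {n} → Vertex n → Vertex n → ℕ
hamming [] [] = 0
hamming (true ∷ x) (true ∷ y) = hamming x y
hamming (false ∷ x) (false ∷ y) = hamming x y
hamming (true ∷ x) (false ∷ y) = suc (hamming x y)
hamming (false ∷ x) (true ∷ y) = suc (hamming x y)

Adjacent : ∀ {n} → Vertex n → Vertex n → Set
Adjacent x y = hamming x y ≡ 1

weight : ∀ {n} → Vertex n → ℕ
weight [] = 0
weight (true ∷ x) = suc (weight x)
weight (false ∷ x) = weight x

-- Bipartition classes: V₀ = even weight, V₁ = odd weight (as a Boolean test).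
isEven : ∀ {n} → Vertex n → Bool
isEven x = ⌊ weight x % 2 ≟ 0 ⌋

isOdd : ∀ {n} → Vertex n → Bool
isOdd x = ⌊ weight x % 2 ≟ 1 ⌋

Independent : ∀ {n} → List (Vertex n) → Set
Independent {n} I = Unique I × (∀ {x y} → x ∈ I → y ∈ I → ¬ Adjacent x y)

EquiIndependent : ∀ {n} → List (Vertex n) → Set
EquiIndependent I =
  Independent I × (length (filter (λ x → isEven x Data.Bool.≟ true) I) ≡ length (filter (λ x → isOdd x Data.Bool.≟ true) I))

-- The set of vertices 00x with x of even weight together with the vertices 11x with x
-- of odd weight (x ∈ Q_{n-2}) is independent: within either half the weights have equal
-- parity, and adjacent vertices always have weights of opposite parity; across the two
-- halves the first two coordinates already differ. All vertices 00x lie in V₀ and all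
-- vertices 11x in V₁, and for n - 2 ≥ 1 each half has 2^{n-3} elements.
module Submission where

open import Defs
open import Data.Nat using (ℕ; zero; suc; _+_; _^_; _∸_; _≤_; s≤s; _%_; _≟_; parity)
open import Data.Nat.Properties using (≤-reflexive; +-identityʳ)
open import Data.Parity.Base as ℙ using (Parity; 0ℙ; 1ℙ; _⁻¹)
open import Data.Parity.Properties using (⁻¹-involutive; ⁻¹-selfInverse; p+p≡0ℙ; +-homo-+)
open import Data.Bool as Bool using (Bool; true; false)
open import Data.Bool.Properties using (not-¬)
open import Data.Vec using ([]; _∷_)
open import Data.Vec.Properties using (∷-injectiveʳ)
open import Data.List using (List; []; _∷_; [_]; map; _++_; length; filter)
open import Data.List.Properties using (length-map; length-++; filter-all; filter-none; filter-++; ++-identityʳ)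
open import Data.List.Relation.Unary.All as All using (All)
import Data.List.Relation.Unary.All.Properties as Allₚ
open import Data.List.Relation.Unary.AllPairs using ([]; _∷_)
open import Data.List.Relation.Unary.Unique.Propositional using (Unique)
import Data.List.Relation.Unary.Unique.Propositional.Properties as Unique
open import Data.List.Relation.Binary.Disjoint.Propositional using (Disjoint)
open import Data.List.Membership.Propositional using (_∈_)
open import Data.List.Membership.Propositional.Properties using (∈-map⁻; ∈-++⁻)
open import Data.Product using (Σ; ∃-syntax; _×_; _,_)
open import Data.Sum as Sum using (_⊎_; inj₁; inj₂)
open import Function using (_∘_)
open import Relation.Nullary using (¬_; contradiction)
open import Relation.Unary using (Decidable; ∁)
open import Relation.Nullary.Decidable using (⌊_⌋)
open import Relation.Binary.PropositionalEquality using (_≡_; _≢_; refl; sym; trans; cong; cong₂; module ≡-Reasoning)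

private
  variable
    m : ℕ
    A B : Set

parity-suc : ∀ n → parity (suc n) ≡ parity n ⁻¹
parity-suc n = +-homo-+ 1 n

⁻¹-distribˡ-+ : ∀ p q → (p ℙ.+ q) ⁻¹ ≡ p ⁻¹ ℙ.+ q
⁻¹-distribˡ-+ 0ℙ q = refl
⁻¹-distribˡ-+ 1ℙ q = ⁻¹-involutive q

⁻¹-distribʳ-+ : ∀ p q → (p ℙ.+ q) ⁻¹ ≡ p ℙ.+ q ⁻¹
⁻¹-distribʳ-+ 0ℙ q = refl
⁻¹-distribʳ-+ 1ℙ q = refl

⁻¹-+-⁻¹ : ∀ p q → p ⁻¹ ℙ.+ q ⁻¹ ≡ p ℙ.+ q
⁻¹-+-⁻¹ 0ℙ q = ⁻¹-involutive q
⁻¹-+-⁻¹ 1ℙ q = refl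

weightParity : ∀ {n} → Vertex n → Parity
weightParity x = parity (weight x)

hamming-parity : ∀ {n} (x y : Vertex n) →
                 parity (hamming x y) ≡ weightParity x ℙ.+ weightParity y
hamming-parity [] [] = refl
hamming-parity (false ∷ x) (false ∷ y) = hamming-parity x y
hamming-parity (true ∷ x) (true ∷ y) = begin
  parity (hamming x y)                                  ≡⟨ hamming-parity x y ⟩
  weightParity x ℙ.+ weightParity y                     ≡⟨ ⁻¹-+-⁻¹ (weightParity x) _ ⟨
  weightParity x ⁻¹ ℙ.+ weightParity y ⁻¹               ≡⟨ cong₂ ℙ._+_ (parity-suc (weight x)) (parity-suc (weight y)) ⟨
  weightParity (true ∷ x) ℙ.+ weightParity (true ∷ y)   ∎
  where open ≡-Reasoning
hamming-parity (true ∷ x) (false ∷ y) = begin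
  parity (suc (hamming x y))                   ≡⟨ parity-suc (hamming x y) ⟩
  parity (hamming x y) ⁻¹                      ≡⟨ cong _⁻¹ (hamming-parity x y) ⟩
  (weightParity x ℙ.+ weightParity y) ⁻¹       ≡⟨ ⁻¹-distribˡ-+ (weightParity x) _ ⟩
  weightParity x ⁻¹ ℙ.+ weightParity y         ≡⟨ cong (ℙ._+ weightParity y) (parity-suc (weight x)) ⟨
  weightParity (true ∷ x) ℙ.+ weightParity y   ∎
  where open ≡-Reasoning
hamming-parity (false ∷ x) (true ∷ y) = begin
  parity (suc (hamming x y))                   ≡⟨ parity-suc (hamming x y) ⟩
  parity (hamming x y) ⁻¹                      ≡⟨ cong _⁻¹ (hamming-parity x y) ⟩
  (weightParity x ℙ.+ weightParity y) ⁻¹       ≡⟨ ⁻¹-distribʳ-+ (weightParity x) _ ⟩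
  weightParity x ℙ.+ weightParity y ⁻¹         ≡⟨ cong (weightParity x ℙ.+_) (parity-suc (weight y)) ⟨
  weightParity x ℙ.+ weightParity (true ∷ y)   ∎
  where open ≡-Reasoning

sameParity⇒¬Adjacent : ∀ {n} {x y : Vertex n} →
                       weightParity x ≡ weightParity y → ¬ Adjacent x y
sameParity⇒¬Adjacent {x = x} {y} eq adj = contradiction 1ℙ≡0ℙ λ ()
  where
  open ≡-Reasoning
  1ℙ≡0ℙ : 1ℙ ≡ 0ℙ
  1ℙ≡0ℙ = begin
    parity 1                            ≡⟨ cong parity adj ⟨
    parity (hamming x y)                ≡⟨ hamming-parity x y ⟩
    weightParity x ℙ.+ weightParity y   ≡⟨ cong (weightParity x ℙ.+_) eq ⟨
    weightParity x ℙ.+ weightParity x   ≡⟨ p+p≡0ℙ (weightParity x) ⟩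
    0ℙ                                  ∎

toℕ : Parity → ℕ
toℕ 0ℙ = 0
toℕ 1ℙ = 1

n%2≡toℕ-parity : ∀ n → n % 2 ≡ toℕ (parity n)
n%2≡toℕ-parity zero = refl
n%2≡toℕ-parity (suc zero) = refl
n%2≡toℕ-parity (suc (suc n)) = n%2≡toℕ-parity n

isEven-parity : ∀ {n p} {x : Vertex n} → weightParity x ≡ p → isEven x ≡ ⌊ toℕ p ≟ 0 ⌋
isEven-parity {x = x} refl = cong (λ k → ⌊ k ≟ 0 ⌋) (n%2≡toℕ-parity (weight x))

isOdd-parity : ∀ {n p} {x : Vertex n} → weightParity x ≡ p → isOdd x ≡ ⌊ toℕ p ≟ 1 ⌋
isOdd-parity {x = x} refl = cong (λ k → ⌊ k ≟ 1 ⌋) (n%2≡toℕ-parity (weight x))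

-- The recursive clause comes first so that Agda splits on m before p, making
-- layer p (suc m) reduce for a variable parity p.
layer : Parity → (m : ℕ) → List (Vertex m)
layer p  (suc m) = map (false ∷_) (layer p m) ++ map (true ∷_) (layer (p ⁻¹) m)
layer 0ℙ zero    = [ [] ]
layer 1ℙ zero    = []

layer-parity : ∀ p m → All (λ x → weightParity x ≡ p) (layer p m)
layer-parity 0ℙ zero    = refl All.∷ All.[]
layer-parity 1ℙ zero    = All.[]
layer-parity p  (suc m) = Allₚ.++⁺ (Allₚ.map⁺ {f = false ∷_} (layer-parity p m))
                                  (Allₚ.map⁺ {f = true ∷_} (All.map (λ {x} → parity-true∷ {x}) (layer-parity (p ⁻¹) m)))
  where
  parity-true∷ : ∀ {x : Vertex m} → weightParity x ≡ p ⁻¹ → weightParity (true ∷ x) ≡ p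
  parity-true∷ {x} eq = trans (parity-suc (weight x)) (⁻¹-selfInverse (sym eq))

sameLayer⇒¬Adjacent : ∀ {p} {x y : Vertex m} → x ∈ layer p m → y ∈ layer p m → ¬ Adjacent x y
sameLayer⇒¬Adjacent {m} {p} {x} {y} x∈ y∈ =
  sameParity⇒¬Adjacent {x = x} {y} (trans (All.lookup (layer-parity p m) x∈) (sym (All.lookup (layer-parity p m) y∈)))

map-disjoint : ∀ {f g : A → B} {xs ys : List A} → (∀ a c → f a ≢ g c) → Disjoint (map f xs) (map g ys)
map-disjoint {f = f} {g} f≢g (v∈fxs , v∈gys) with ∈-map⁻ f v∈fxs | ∈-map⁻ g v∈gys
... | a , _ , refl | c , _ , eq = f≢g a c eq

layer-unique : ∀ p m → Unique (layer p m)
layer-unique 0ℙ zero    = All.[] ∷ []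
layer-unique 1ℙ zero    = []
layer-unique p  (suc m) =
  Unique.++⁺ (Unique.map⁺ ∷-injectiveʳ (layer-unique p m))
             (Unique.map⁺ ∷-injectiveʳ (layer-unique (p ⁻¹) m))
             (map-disjoint λ _ _ ())

length-map-++-map : ∀ (f g : A → B) xs ys → length (map f xs ++ map g ys) ≡ length xs + length ys
length-map-++-map f g xs ys =
  trans (length-++ (map f xs)) (cong₂ _+_ (length-map f xs) (length-map g ys))

length-layer-suc : ∀ p m → length (layer p (suc m)) ≡ 2 ^ m
length-layer-suc 0ℙ zero    = refl
length-layer-suc 1ℙ zero    = refl
length-layer-suc p  (suc m) = begin
  length (layer p (suc (suc m)))                          ≡⟨ length-map-++-map _ _ (layer p (suc m)) _ ⟩
  length (layer p (suc m)) + length (layer (p ⁻¹) (suc m)) ≡⟨ cong₂ _+_ (length-layer-suc p m) (length-layer-suc (p ⁻¹) m) ⟩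
  2 ^ m + 2 ^ m                                           ≡⟨ cong (2 ^ m +_) (+-identityʳ (2 ^ m)) ⟨
  2 ^ suc m                                               ∎
  where open ≡-Reasoning

prefix : Bool → Vertex m → Vertex (2 + m)
prefix b x = b ∷ b ∷ x

prefixedLayers : (m : ℕ) → List (Vertex (2 + m))
prefixedLayers m = map (prefix false) (layer 0ℙ m) ++ map (prefix true) (layer 1ℙ m)

length-prefixedLayers : ∀ m → length (prefixedLayers m) ≡ 2 ^ m
length-prefixedLayers m = begin
  length (prefixedLayers m)                  ≡⟨ length-map-++-map _ _ (layer 0ℙ m) _ ⟩
  length (layer 0ℙ m) + length (layer 1ℙ m)  ≡⟨ length-map-++-map _ _ (layer 0ℙ m) _ ⟨
  length (layer 0ℙ (suc m))                  ≡⟨ length-layer-suc 0ℙ m ⟩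
  2 ^ m                                      ∎
  where open ≡-Reasoning

∈-prefixedLayers⁻ : ∀ {x} → x ∈ prefixedLayers m →
                    (∃[ a ] a ∈ layer 0ℙ m × x ≡ prefix false a) ⊎ (∃[ a ] a ∈ layer 1ℙ m × x ≡ prefix true a)
∈-prefixedLayers⁻ {m} = Sum.map (∈-map⁻ (prefix false)) (∈-map⁻ (prefix true)) ∘ ∈-++⁻ (map (prefix false) (layer 0ℙ m))

prefixedLayers-independent : ∀ m → Independent (prefixedLayers m)
prefixedLayers-independent m = unique , nonadjacent
  where
  prefix-injective : ∀ {b} {x y : Vertex m} → prefix b x ≡ prefix b y → x ≡ y
  prefix-injective = ∷-injectiveʳ ∘ ∷-injectiveʳ

  unique : Unique (prefixedLayers m)
  unique = Unique.++⁺ (Unique.map⁺ prefix-injective (layer-unique 0ℙ m))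
                      (Unique.map⁺ prefix-injective (layer-unique 1ℙ m))
                      (map-disjoint λ _ _ ())

  nonadjacent : ∀ {x y} → x ∈ prefixedLayers m → y ∈ prefixedLayers m → ¬ Adjacent x y
  nonadjacent x∈ y∈ with ∈-prefixedLayers⁻ x∈ | ∈-prefixedLayers⁻ y∈
  ... | inj₁ (_ , a∈ , refl) | inj₁ (_ , c∈ , refl) = sameLayer⇒¬Adjacent a∈ c∈
  ... | inj₂ (_ , a∈ , refl) | inj₂ (_ , c∈ , refl) = sameLayer⇒¬Adjacent a∈ c∈
  ... | inj₁ (_ , _  , refl) | inj₂ (_ , _  , refl) = λ ()
  ... | inj₂ (_ , _  , refl) | inj₁ (_ , _  , refl) = λ ()

filter-++-accept-reject : ∀ {P : A → Set} (P? : Decidable P) {xs ys} →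
                          All P xs → All (∁ P) ys → filter P? (xs ++ ys) ≡ xs
filter-++-accept-reject P? {xs} {ys} pxs ¬pys =
  trans (filter-++ P? xs ys) (trans (cong₂ _++_ (filter-all P? pxs) (filter-none P? ¬pys)) (++-identityʳ xs))

filter-++-reject-accept : ∀ {P : A → Set} (P? : Decidable P) {xs ys} →
                          All (∁ P) xs → All P ys → filter P? (xs ++ ys) ≡ ys
filter-++-reject-accept P? {xs} {ys} ¬pxs pys =
  trans (filter-++ P? xs ys) (cong₂ _++_ (filter-none P? ¬pxs) (filter-all P? pys))

module _ (m : ℕ) where

  filter-isEven-prefixedLayers : filter (λ x → isEven x Bool.≟ true) (prefixedLayers m) ≡ map (prefix false) (layer 0ℙ m)
  filter-isEven-prefixedLayers = filter-++-accept-reject (λ x → isEven x Bool.≟ true)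
    (Allₚ.map⁺ (All.map (λ {a} → isEven-parity {x = prefix false a}) (layer-parity 0ℙ m)))
    (Allₚ.map⁺ (All.map (λ {a} → not-¬ ∘ isEven-parity {x = prefix true a}) (layer-parity 1ℙ m)))

  filter-isOdd-prefixedLayers : filter (λ x → isOdd x Bool.≟ true) (prefixedLayers m) ≡ map (prefix true) (layer 1ℙ m)
  filter-isOdd-prefixedLayers = filter-++-reject-accept (λ x → isOdd x Bool.≟ true)
    (Allₚ.map⁺ (All.map (λ {a} → not-¬ ∘ isOdd-parity {x = prefix false a}) (layer-parity 0ℙ m)))
    (Allₚ.map⁺ (All.map (λ {a} → isOdd-parity {x = prefix true a}) (layer-parity 1ℙ m)))

prefixedLayers-equiIndependent : ∀ m → EquiIndependent (prefixedLayers (suc m))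
prefixedLayers-equiIndependent m = prefixedLayers-independent (suc m) , (begin
  length (filter (λ x → isEven x Bool.≟ true) (prefixedLayers (suc m))) ≡⟨ cong length (filter-isEven-prefixedLayers (suc m)) ⟩
  length (map (prefix false) (layer 0ℙ (suc m)))                       ≡⟨ length-map (prefix false) (layer 0ℙ (suc m)) ⟩
  length (layer 0ℙ (suc m))                                             ≡⟨ length-layer-suc 0ℙ m ⟩
  2 ^ m                                                                 ≡⟨ length-layer-suc 1ℙ m ⟨
  length (layer 1ℙ (suc m))                                             ≡⟨ length-map (prefix true) (layer 1ℙ (suc m)) ⟨
  length (map (prefix true) (layer 1ℙ (suc m)))                         ≡⟨ cong length (filter-isOdd-prefixedLayers (suc m)) ⟨
  length (filter (λ x → isOdd x Bool.≟ true) (prefixedLayers (suc m)))  ∎)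
  where open ≡-Reasoning

theorem4 : (n : ℕ) → 3 ≤ n →
    Σ (List (Vertex n)) (λ I → EquiIndependent I × 2 ^ (n ∸ 2) ≤ length I)
theorem4 (suc (suc (suc k))) _ =
  prefixedLayers (suc k) , prefixedLayers-equiIndependent k , ≤-reflexive (sym (length-prefixedLayers (suc k)))
theorem4 0 ()
theorem4 1 (s≤s ())
theorem4 2 (s≤s (s≤s ()))
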